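{- For all $i,j\in\mathbb Z^{\geq 0}$ and all $n\in\mathbb N$: (i) $f_{i,j}(n)+1=f_{i,j-1}(n)$; (ii) $f_{i+1,j}(n)+1=f_{i+1,j-1}(n)$; (iii) $f_{i,0}(a(n))+1=f_{i+1,F(i+1)-1}(n)$; (iv) $f_{i,0}(b(n))+1=f_{i,F(i+2)-1}(b(n)+1)$; (v) $f_{i+1,0}(n)+1=f_{i,F(i+2)-1}(a(n)+1)$.
   Context: Let $\varphi=\frac{1+\sqrt5}{2}$ and $\mathbb N=\{1,2,3,\dots\}$. For $n\in\mathbb N$ put $a(n)=\lfloor n\varphi\rfloor$ and $b(n)=\lfloor n\varphi^2\rfloor$. $F$ is the Fibonacci sequence, $F(0)=0$, $F(1)=F(2)=1$, $F(n)=F(n-1)+F(n-2)$. For $i\in\mathbb Z^{\geq0}$ and $j\in\mathbb Z$, $f_{i,j}(n)=F(i+1)a(n)+F(i)n-j$ for $n\in\mathbb N$. -}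

module Defs where

open import Data.Nat using (ℕ; zero; suc; _+_; _*_; _/_; _≤ᵇ_)
open import Data.Bool using (if_then_else_)
open import Data.Integer as ℤ using (ℤ; +_)

isqrt : ℕ → ℕ
isqrt zero = zero
isqrt (suc N) with isqrt N
... | r = if (suc r * suc r) ≤ᵇ suc N then suc r else r

-- φ = (1 + √5)/2, so n φ = (n + √(5 n²))/2 and
-- ⌊n φ⌋ = ⌊(n + ⌊√(5 n²)⌋)/2⌋.
a : ℕ → ℕ
a n = (n + isqrt (5 * (n * n))) / 2

-- φ² = (3 + √5)/2, so ⌊n φ²⌋ = ⌊(3n + ⌊√(5 n²)⌋)/2⌋.
b : ℕ → ℕ
b n = (3 * n + isqrt (5 * (n * n))) / 2

F : ℕ → ℕ
F zero = zero
F (suc zero) = suc zero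
F (suc (suc n)) = F (suc n) + F n

f : ℕ → ℤ → ℕ → ℤ
f i j n = + (F (suc i) * a n + F i * n) ℤ.- j

-- Since φ² = φ + 1, the integer k = ⌊nφ⌋ is characterised by k² − kn ≤ n² < (k+1)² − (k+1)n
-- (a real x ≥ 0 satisfies x ≤ φ iff x² ≤ x + 1).  The quadratic form k² − kn − n² changes sign
-- under (k, n) ↦ (k + n, k) and never vanishes for n ≥ 1 (φ is irrational); checking the
-- characterisation for the claimed values gives, for n ≥ 1,
--   a(a(n)) = a(n) + n − 1,   a(a(n) + 1) = a(n) + n + 1,   b(n) = a(n) + n,   a(b(n) + 1) = a(b(n)) + 1.
-- With F(i+2) = F(i+1) + F(i), items (iii)–(v) are linear consequences of these, and (i), (ii)
-- hold because f_{i,j}(n) is affine in j with slope −1.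
module Submission where

open import Defs
open import Data.Bool using (true; false; T)
open import Data.Empty using (⊥-elim)
open import Data.Integer as ℤ using (ℤ; +_)
open import Data.Integer.Properties using (pos-+)
import Data.Integer.Tactic.RingSolver as ℤ-Solver
open import Data.Nat
open import Data.Nat.DivMod
open import Data.Nat.Divisibility using (divides-refl)
open import Data.Nat.Induction using (<-rec)
open import Data.Nat.Properties
open import Data.Nat.Tactic.RingSolver using (solve-∀)
open import Data.Product using (_×_; _,_; proj₁; proj₂)
open import Data.Unit using (tt)
open import Relation.Binary.Definitions using (tri<; tri≈; tri>)
open import Relation.Binary.PropositionalEquality
open import Relation.Nullary using (¬_; yes; no)

isqrt-correct : ∀ N → isqrt N * isqrt N ≤ N × N < suc (isqrt N) * suc (isqrt N)
isqrt-correct zero = z≤n , s≤s z≤n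
isqrt-correct (suc N) with isqrt N | isqrt-correct N
... | r | (r²≤N , N<[1+r]²) with suc r * suc r ≤ᵇ suc N in eq
... | true  = ≤ᵇ⇒≤ (suc r * suc r) (suc N) (subst T (sym eq) tt)
            , ≤-<-trans N<[1+r]² (*-mono-< (n<1+n (suc r)) (n<1+n (suc r)))
... | false = ≤-trans r²≤N (n≤1+n N) , ≰⇒> (λ le → subst T eq (≤⇒≤ᵇ le))

-- Turns an inequality into a semiring identity (no subtraction) plus a known inequality u ≤ v.
≤-by-identity : ∀ {x y u v} s → u ≤ v → x + v + s ≡ y + u → x ≤ y
≤-by-identity {x} {y} {u} {v} s u≤v eq = +-cancelʳ-≤ v x y (begin
  x + v      ≤⟨ m≤m+n (x + v) s ⟩
  x + v + s  ≡⟨ eq ⟩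
  y + u      ≤⟨ +-monoʳ-≤ y u≤v ⟩
  y + v      ∎)
  where open ≤-Reasoning

-- FloorMulφ n k  ⇔  k = ⌊nφ⌋
record FloorMulφ (n k : ℕ) : Set where
  field
    lower : k * k ≤ k * n + n * n
    upper : suc k * n + n * n < suc k * suc k

open FloorMulφ

-- Multiplying by 4 turns k² ≤ kn + n² into (2k − n)² ≤ 5n², and similarly for k + 1.
floorMulφ-from-sqrt5 : ∀ n k t → k * 2 ≡ n + t →
  t * t ≤ 5 * (n * n) → 5 * (n * n) < suc (suc t) * suc (suc t) → FloorMulφ n k
floorMulφ-from-sqrt5 n k t 2k≡n+t t²≤5n² 5n²<[t+2]² = record
  { lower = *-cancelˡ-≤ 4 (begin
      4 * (k * k)                    ≡⟨ quadruple k ⟩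
      (k * 2) * (k * 2)              ≡⟨ cong (λ m → m * m) 2k≡n+t ⟩
      (n + t) * (n + t)              ≤⟨ ≤-by-identity 0 t²≤5n² (lower-identity n t) ⟩
      2 * n * (n + t) + 4 * (n * n)  ≡⟨ cong (λ m → 2 * n * m + 4 * (n * n)) (sym 2k≡n+t) ⟩
      2 * n * (k * 2) + 4 * (n * n)  ≡⟨ quadruple-rhs k n ⟩
      4 * (k * n + n * n)            ∎)
  ; upper = *-cancelˡ-< 4 _ _ (begin-strict
      4 * (suc k * n + n * n)                  ≡⟨ quadruple-rhs-suc k n ⟩
      2 * n * (k * 2 + 2) + 4 * (n * n)        ≡⟨ cong (λ m → 2 * n * (m + 2) + 4 * (n * n)) 2k≡n+t ⟩
      2 * n * (n + t + 2) + 4 * (n * n)        <⟨ ≤-by-identity 0 5n²<[t+2]² (upper-identity n t) ⟩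
      (n + t + 2) * (n + t + 2)                ≡⟨ cong (λ m → (m + 2) * (m + 2)) (sym 2k≡n+t) ⟩
      (k * 2 + 2) * (k * 2 + 2)                ≡⟨ quadruple-suc k ⟩
      4 * (suc k * suc k)                      ∎)
  }
  where
  open ≤-Reasoning
  quadruple : ∀ k → 4 * (k * k) ≡ (k * 2) * (k * 2)
  quadruple = solve-∀
  quadruple-suc : ∀ k → (k * 2 + 2) * (k * 2 + 2) ≡ 4 * (suc k * suc k)
  quadruple-suc = solve-∀
  quadruple-rhs : ∀ k n → 2 * n * (k * 2) + 4 * (n * n) ≡ 4 * (k * n + n * n)
  quadruple-rhs = solve-∀
  quadruple-rhs-suc : ∀ k n → 4 * (suc k * n + n * n) ≡ 2 * n * (k * 2 + 2) + 4 * (n * n)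
  quadruple-rhs-suc = solve-∀
  lower-identity : ∀ n t → (n + t) * (n + t) + 5 * (n * n) + 0 ≡ 2 * n * (n + t) + 4 * (n * n) + t * t
  lower-identity = solve-∀
  upper-identity : ∀ n t → suc (2 * n * (n + t + 2) + 4 * (n * n)) + suc (suc t) * suc (suc t) + 0
                         ≡ (n + t + 2) * (n + t + 2) + suc (5 * (n * n))
  upper-identity = solve-∀

-- With s = ⌊√(5n²)⌋ and n + s = r + 2k, the value t = s − r satisfies t ≤ √(5n²) < t + 2.
floorMulφ-from-parity : ∀ n s r k → s * s ≤ 5 * (n * n) → 5 * (n * n) < suc s * suc s →
  r < 2 → n + s ≡ r + k * 2 → FloorMulφ n k
floorMulφ-from-parity n s zero k s²≤ <[s+1]² _ eq =
  floorMulφ-from-sqrt5 n k s (sym eq) s²≤ (<-≤-trans <[s+1]² (*-mono-≤ (n≤1+n (suc s)) (n≤1+n (suc s))))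
floorMulφ-from-parity zero    zero (suc zero) k _ _ _ ()
floorMulφ-from-parity (suc n) zero (suc zero) k _ (s≤s ()) _ _
floorMulφ-from-parity n (suc s) (suc zero) k [s+1]²≤ <[s+2]² _ eq =
  floorMulφ-from-sqrt5 n k s (suc-injective (trans (sym eq) (+-suc n s)))
    (≤-trans (*-mono-≤ (n≤1+n s) (n≤1+n s)) [s+1]²≤) <[s+2]²
floorMulφ-from-parity n s (suc (suc r)) k _ _ (s≤s (s≤s ())) _

a-floorMulφ : ∀ n → FloorMulφ n (a n)
a-floorMulφ n = floorMulφ-from-parity n s ((n + s) % 2) ((n + s) / 2)
  (proj₁ (isqrt-correct (5 * (n * n)))) (proj₂ (isqrt-correct (5 * (n * n))))
  (m%n<n (n + s) 2) (m≡m%n+[m/n]*n (n + s) 2)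
  where s = isqrt (5 * (n * n))

b≡a+id : ∀ n → b n ≡ a n + n
b≡a+id n = begin
  (3 * n + s) / 2          ≡⟨ /-congˡ (regroup n s) ⟩
  ((n + s) + n * 2) / 2    ≡⟨ +-distrib-/-∣ʳ (n + s) (divides-refl n) ⟩
  (n + s) / 2 + n * 2 / 2  ≡⟨ cong (λ q → (n + s) / 2 + q) (m*n/n≡m n 2) ⟩
  a n + n                  ∎
  where
  open ≡-Reasoning
  s = isqrt (5 * (n * n))
  regroup : ∀ n s → 3 * n + s ≡ (n + s) + n * 2
  regroup = solve-∀

floorMulφ-≥ : ∀ {n k} → FloorMulφ n k → n ≤ k
floorMulφ-≥ {n} {k} fk = ≮⇒≥ λ k<n → <⇒≱ (upper fk) (begin
  suc k * suc k      ≤⟨ *-monoʳ-≤ (suc k) k<n ⟩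
  suc k * n          ≤⟨ m≤m+n (suc k * n) (n * n) ⟩
  suc k * n + n * n  ∎)
  where open ≤-Reasoning

-- (k + 1 + d)² − (k + 1 + d) n exceeds (k + 1)² − (k + 1) n by d (2k + 2 + d − n) ≥ 0.
floorMulφ-not-above : ∀ {n k m} → FloorMulφ n k → k < m → ¬ FloorMulφ n m
floorMulφ-not-above {n} {k} fk k<m fm with m≤n⇒∃[o]m+o≡n k<m
... | d , refl = <⇒≱
  (≤-by-identity (suc k * d + d * d + d)
    (+-mono-≤ (upper fk) (*-monoʳ-≤ d (s≤s (floorMulφ-≥ fk))))
    (identity (suc k) d n))
  (lower fm)
  where
  identity : ∀ p d n → suc ((p + d) * n + n * n) + (p * p + d * p) + (p * d + d * d + d)
                     ≡ (p + d) * (p + d) + (suc (p * n + n * n) + d * suc n)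
  identity = solve-∀

floorMulφ-unique : ∀ {n k m} → FloorMulφ n k → FloorMulφ n m → k ≡ m
floorMulφ-unique {n} {k} {m} fk fm with <-cmp k m
... | tri< k<m _ _ = ⊥-elim (floorMulφ-not-above fk k<m fm)
... | tri≈ _ k≡m _ = k≡m
... | tri> _ _ m<k = ⊥-elim (floorMulφ-not-above fm m<k fk)

square<square+square : ∀ {k n} → 1 ≤ n → k ≤ n → k * k < k * n + n * n
square<square+square {k} {n} 1≤n k≤n = ≤-<-trans (*-monoʳ-≤ k k≤n) (m<m+n (k * n) (*-mono-≤ 1≤n 1≤n))

-- Infinite descent: a solution (n + c, n) of k² = kn + n² yields the smaller solution (n, c).
φ-irrational : ∀ n k → 1 ≤ n → k * k ≢ k * n + n * n
φ-irrational = <-rec _ descent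
  where
  descent : ∀ n → (∀ {c} → c < n → ∀ k → 1 ≤ c → k * k ≢ k * c + c * c) →
            ∀ k → 1 ≤ n → k * k ≢ k * n + n * n
  descent n rec k 1≤n eq with k ≤? n
  ... | yes k≤n = <⇒≢ (square<square+square 1≤n k≤n) eq
  ... | no k≰n with m≤n⇒∃[o]m+o≡n (≰⇒> k≰n)
  ... | d , refl = rec c<n n (s≤s z≤n) n²≡nc+c²
    where
    c = suc d
    left : ∀ n d → (n * suc d + suc d * suc d) + (n * n + n * suc d) ≡ (suc n + d) * (suc n + d)
    left = solve-∀
    right : ∀ n d → (suc n + d) * n + n * n ≡ n * n + (n * n + n * suc d)
    right = solve-∀
    n²≡nc+c² : n * n ≡ n * c + c * c
    n²≡nc+c² = sym (+-cancelʳ-≡ (n * n + n * c) (n * c + c * c) (n * n)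
                     (trans (left n d) (trans eq (right n d))))
    c<n : c < n
    c<n = ≰⇒> λ n≤c → <⇒≢ (square<square+square (s≤s z≤n) n≤c) n²≡nc+c²

floorMulφ-strict : ∀ {n k} → 1 ≤ n → FloorMulφ n k → k * k < k * n + n * n
floorMulφ-strict {n} {k} 1≤n fk = ≤∧≢⇒< (lower fk) (φ-irrational n k 1≤n)

floorMulφ-<2n : ∀ {n k} → 1 ≤ n → FloorMulφ n k → k < 2 * n
floorMulφ-<2n {n} {k} 1≤n fk = ≰⇒> λ 2n≤k → <⇒≱ (too-large 2n≤k) (lower fk)
  where
  open ≤-Reasoning
  too-large : 2 * n ≤ k → k * n + n * n < k * k
  too-large 2n≤k = begin-strict
    k * n + n * n            <⟨ +-monoʳ-< (k * n) (m<m+n (n * n) (*-mono-≤ 1≤n 1≤n)) ⟩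
    k * n + (n * n + n * n)  ≡⟨ cong (λ x → k * n + x) (double n) ⟩
    k * n + 2 * n * n        ≤⟨ +-monoʳ-≤ (k * n) (*-monoˡ-≤ n 2n≤k) ⟩
    k * n + k * n            ≡⟨ split k n ⟩
    k * (2 * n)              ≤⟨ *-monoʳ-≤ k 2n≤k ⟩
    k * k                    ∎
    where
    double : ∀ n → n * n + n * n ≡ 2 * n * n
    double = solve-∀
    split : ∀ k n → k * n + k * n ≡ k * (2 * n)
    split = solve-∀

floorMulφ-swap : ∀ {n k} → FloorMulφ (suc n) k → FloorMulφ k (k + n)
floorMulφ-swap {n} {k} fk = record
  { lower = ≤-by-identity 0
      (+-mono-≤ (upper fk) (≤-trans (floorMulφ-<2n (s≤s z≤n) fk) (*-monoˡ-≤ (suc n) (n≤1+n 2))))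
      (lower-identity k n)
  ; upper = ≤-by-identity 0 (floorMulφ-strict (s≤s z≤n) fk) (upper-identity k n)
  }
  where
  lower-identity : ∀ k n → (k + n) * (k + n) + (suc k * suc k + 3 * suc n) + 0
                         ≡ (k + n) * k + k * k + (suc (suc k * suc n + suc n * suc n) + suc k)
  lower-identity = solve-∀
  upper-identity : ∀ k n → suc (suc (k + n) * k + k * k) + (k * suc n + suc n * suc n) + 0
                         ≡ suc (k + n) * suc (k + n) + suc (k * k)
  upper-identity = solve-∀

floorMulφ-swap-suc : ∀ {n k} → 1 ≤ n → FloorMulφ n k → FloorMulφ (suc k) (suc k + n)
floorMulφ-swap-suc {n} {k} 1≤n fk = record
  { lower = ≤-by-identity 1 (upper fk) (lower-identity (suc k) n)
  ; upper = ≤-by-identity 0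
      (+-mono-≤ (lower fk) (≤-trans (n≤1+n k) (≤-trans (floorMulφ-<2n 1≤n fk) (*-monoˡ-≤ n (n≤1+n 2)))))
      (upper-identity k n)
  }
  where
  lower-identity : ∀ p n → (p + n) * (p + n) + p * p + 1 ≡ (p + n) * p + p * p + suc (p * n + n * n)
  lower-identity = solve-∀
  upper-identity : ∀ k n → suc (suc (suc k + n) * suc k + suc k * suc k) + (k * n + n * n + 3 * n) + 0
                         ≡ suc (suc k + n) * suc (suc k + n) + (k * k + k)
  upper-identity = solve-∀

floorMulφ-add : ∀ {n k} → FloorMulφ n k → FloorMulφ (k + n) (k + k + n)
floorMulφ-add {n} {k} fk = record
  { lower = ≤-by-identity 0 (lower fk) (lower-identity k n)
  ; upper = ≤-by-identity (k + n + n) (upper fk) (upper-identity k n)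
  }
  where
  lower-identity : ∀ k n → (k + k + n) * (k + k + n) + (k * n + n * n) + 0
                         ≡ (k + k + n) * (k + n) + (k + n) * (k + n) + k * k
  lower-identity = solve-∀
  upper-identity : ∀ k n → suc (suc (k + k + n) * (k + n) + (k + n) * (k + n)) + suc k * suc k + (k + n + n)
                         ≡ suc (k + k + n) * suc (k + k + n) + suc (suc k * n + n * n)
  upper-identity = solve-∀

floorMulφ-add-suc : ∀ {n k} → FloorMulφ n k → FloorMulφ (suc (k + n)) (suc (k + k + n))
floorMulφ-add-suc {n} {k} fk = record
  { lower = ≤-by-identity (k + n + n + 1) (lower fk) (lower-identity k n)
  ; upper = ≤-by-identity 0 (upper fk) (upper-identity k n)
  }
  where
  lower-identity : ∀ k n → suc (k + k + n) * suc (k + k + n) + (k * n + n * n) + (k + n + n + 1)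
                         ≡ suc (k + k + n) * suc (k + n) + suc (k + n) * suc (k + n) + k * k
  lower-identity = solve-∀
  upper-identity : ∀ k n → suc (suc (suc (k + k + n)) * suc (k + n) + suc (k + n) * suc (k + n)) + suc k * suc k + 0
                         ≡ suc (suc (k + k + n)) * suc (suc (k + k + n)) + suc (suc k * n + n * n)
  upper-identity = solve-∀

a∘a : ∀ n → a (a (suc n)) ≡ a (suc n) + n
a∘a n = floorMulφ-unique (a-floorMulφ (a (suc n))) (floorMulφ-swap (a-floorMulφ (suc n)))

a∘suc∘a : ∀ n → 1 ≤ n → a (a n + 1) ≡ suc (a n) + n
a∘suc∘a n 1≤n = trans (cong a (+-comm (a n) 1))
  (floorMulφ-unique (a-floorMulφ (suc (a n))) (floorMulφ-swap-suc 1≤n (a-floorMulφ n)))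

a∘suc∘b : ∀ n → a (b n + 1) ≡ suc (a (b n))
a∘suc∘b n rewrite b≡a+id n = begin
  a (a n + n + 1)        ≡⟨ cong a (+-comm (a n + n) 1) ⟩
  a (suc (a n + n))      ≡⟨ floorMulφ-unique (a-floorMulφ _) (floorMulφ-add-suc (a-floorMulφ n)) ⟩
  suc (a n + a n + n)    ≡⟨ cong suc (floorMulφ-unique (floorMulφ-add (a-floorMulφ n)) (a-floorMulφ _)) ⟩
  suc (a (a n + n))      ∎
  where open ≡-Reasoning

f-suc : ∀ i j n → f i j n ℤ.+ + 1 ≡ f i (j ℤ.- + 1) n
f-suc i j n = identity (+ (F (suc i) * a n + F i * n)) j
  where
  identity : ∀ x j → x ℤ.- j ℤ.+ + 1 ≡ x ℤ.- (j ℤ.- + 1)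
  identity = ℤ-Solver.solve-∀

f-zero-shift : ∀ i m i′ m′ A → F (suc i) * a m + F i * m + A ≡ F (suc i′) * a m′ + F i′ * m′ →
  f i (+ 0) m ℤ.+ + 1 ≡ f i′ (+ A ℤ.- + 1) m′
f-zero-shift i m i′ m′ A eq = begin
  + x ℤ.- + 0 ℤ.+ + 1              ≡⟨ identity (+ x) (+ A) ⟩
  (+ x ℤ.+ + A) ℤ.- (+ A ℤ.- + 1)  ≡⟨ cong (ℤ._- (+ A ℤ.- + 1)) (trans (sym (pos-+ x A)) (cong +_ eq)) ⟩
  f i′ (+ A ℤ.- + 1) m′            ∎
  where
  open ≡-Reasoning
  x = F (suc i) * a m + F i * m
  identity : ∀ p q → p ℤ.- + 0 ℤ.+ + 1 ≡ (p ℤ.+ q) ℤ.- (q ℤ.- + 1)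
  identity = ℤ-Solver.solve-∀

f-zero-at-a : ∀ i n → f i (+ 0) (a (suc n)) ℤ.+ + 1 ≡ f (suc i) (+ F (suc i) ℤ.- + 1) (suc n)
f-zero-at-a i n = f-zero-shift i (a (suc n)) (suc i) (suc n) (F (suc i)) (begin
  F (suc i) * a (a (suc n)) + F i * a (suc n) + F (suc i)
    ≡⟨ cong (λ x → F (suc i) * x + F i * a (suc n) + F (suc i)) (a∘a n) ⟩
  F (suc i) * (a (suc n) + n) + F i * a (suc n) + F (suc i)
    ≡⟨ identity (F (suc i)) (F i) (a (suc n)) n ⟩
  F (suc (suc i)) * a (suc n) + F (suc i) * suc n  ∎)
  where
  open ≡-Reasoning
  identity : ∀ A B k m → A * (k + m) + B * k + A ≡ (A + B) * k + A * suc m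
  identity = solve-∀

f-zero-at-b : ∀ i n → f i (+ 0) (b n) ℤ.+ + 1 ≡ f i (+ F (suc (suc i)) ℤ.- + 1) (b n + 1)
f-zero-at-b i n = f-zero-shift i (b n) i (b n + 1) (F (suc (suc i))) (begin
  F (suc i) * a (b n) + F i * b n + F (suc (suc i))
    ≡⟨ identity (F (suc i)) (F i) (a (b n)) (b n) ⟩
  F (suc i) * suc (a (b n)) + F i * (b n + 1)
    ≡⟨ cong (λ x → F (suc i) * x + F i * (b n + 1)) (sym (a∘suc∘b n)) ⟩
  F (suc i) * a (b n + 1) + F i * (b n + 1)  ∎)
  where
  open ≡-Reasoning
  identity : ∀ A B x y → A * x + B * y + (A + B) ≡ A * suc x + B * (y + 1)
  identity = solve-∀

f-zero-suc-index : ∀ i n → 1 ≤ n →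
  f (suc i) (+ 0) n ℤ.+ + 1 ≡ f i (+ F (suc (suc i)) ℤ.- + 1) (a n + 1)
f-zero-suc-index i n 1≤n = f-zero-shift (suc i) n i (a n + 1) (F (suc (suc i))) (begin
  F (suc (suc i)) * a n + F (suc i) * n + F (suc (suc i))
    ≡⟨ identity (F (suc i)) (F i) (a n) n ⟩
  F (suc i) * (suc (a n) + n) + F i * (a n + 1)
    ≡⟨ cong (λ x → F (suc i) * x + F i * (a n + 1)) (sym (a∘suc∘a n 1≤n)) ⟩
  F (suc i) * a (a n + 1) + F i * (a n + 1)  ∎)
  where
  open ≡-Reasoning
  identity : ∀ A B k n → (A + B) * k + A * n + (A + B) ≡ A * (suc k + n) + B * (k + 1)
  identity = solve-∀

proposition3p5 : (i j n : ℕ) → 1 ≤ n →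
    (f i (+ j) n ℤ.+ + 1 ≡ f i (+ j ℤ.- + 1) n)
    × (f (suc i) (+ j) n ℤ.+ + 1 ≡ f (suc i) (+ j ℤ.- + 1) n)
    × (f i (+ 0) (a n) ℤ.+ + 1 ≡ f (suc i) (+ F (suc i) ℤ.- + 1) n)
    × (f i (+ 0) (b n) ℤ.+ + 1 ≡ f i (+ F (suc (suc i)) ℤ.- + 1) (b n + 1))
    × (f (suc i) (+ 0) n ℤ.+ + 1 ≡ f i (+ F (suc (suc i)) ℤ.- + 1) (a n + 1))
proposition3p5 i j n@(suc n-1) 1≤n =
    f-suc i (+ j) n
  , f-suc (suc i) (+ j) n
  , f-zero-at-a i n-1
  , f-zero-at-b i n
  , f-zero-suc-index i n 1≤n
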